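{- Let $m,n\geq 2$ and $p\ge 2$ be integers. Then \[z(m,n, \theta_{3,p})\leq 144p^3\cdot \left((mn)^{2/3}+m+n\right).\]
   Context: $\theta_{3,p}$ denotes the graph consisting of $p$ internally vertex-disjoint paths of length $3$ joining a fixed pair of vertices. $z(m,n,H)$ is the maximum number of edges in a bipartite graph with parts of sizes $m$ and $n$ that contains no copy of $H$ as a subgraph. -}

module Defs where

open import Data.Nat using (ℕ; _+_; _*_; _∸_; _^_; _≤_)
open import Data.Fin using (Fin)
open import Data.Bool using (Bool; true; false; T; if_then_else_)
open import Data.List using (List; map; allFin)
open import Data.Nat.ListAction using (sum)
open import Data.Sum using (_⊎_; inj₁; inj₂)
open import Data.Product using (_×_; Σ; ∃; ∃-syntax)
open import Data.Empty using (⊥)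
open import Function.Definitions using (Injective)
open import Relation.Binary.PropositionalEquality using (_≡_)

BipGraph : ℕ → ℕ → Set
BipGraph m n = Fin m → Fin n → Bool

edges : ∀ {m n} → BipGraph m n → ℕ
edges {m} {n} G =
  sum (map (λ i → sum (map (λ j → if G i j then 1 else 0) (allFin n))) (allFin m))

Adj : ∀ {m n} → BipGraph m n → Fin m ⊎ Fin n → Fin m ⊎ Fin n → Set
Adj G (inj₁ i) (inj₂ j) = T (G i j)
Adj G (inj₂ j) (inj₁ i) = T (G i j)
Adj G (inj₁ _) (inj₁ _) = ⊥
Adj G (inj₂ _) (inj₂ _) = ⊥

-- The graph θ_{3,p}: endpoints s, t and p internally disjoint paths s - a i - b i - t.
data ThetaV (p : ℕ) : Set where
  s t : ThetaV p
  a b : Fin p → ThetaV p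

data ThetaE {p : ℕ} : ThetaV p → ThetaV p → Set where
  sa : ∀ i → ThetaE s (a i)
  as : ∀ i → ThetaE (a i) s
  ab : ∀ i → ThetaE (a i) (b i)
  ba : ∀ i → ThetaE (b i) (a i)
  bt : ∀ i → ThetaE (b i) t
  tb : ∀ i → ThetaE t (b i)

ContainsTheta : ∀ {m n} → (p : ℕ) → BipGraph m n → Set
ContainsTheta {m} {n} p G =
  ∃[ f ] (Injective _≡_ _≡_ f × (∀ x y → ThetaE {p} x y → Adj G (f x) (f y)))

-- Delete vertices of A of degree below e/4m and vertices of B of degree below e/4n one at
-- a time (e the number of edges); fewer than e/2 edges are lost, and afterwards every edge
-- yx has d(y) ≥ e/4m and d(x) ≥ e/4n.  At least (d(x) − 1)(d(y) − 1) paths s – x – y – t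
-- have middle edge yx.  Call such a path heavy if s, y or x, t have more than p common
-- neighbours.  Fewer than p vertices s ∼ x have more than p common neighbours with y, since
-- otherwise distinct common neighbours chosen greedily give p paths y – x′ – s – x, a copy
-- of θ_{3,p}; so at most p(d(x) + d(y)) of these paths are heavy, which is negligible once
-- e ≥ 64p(m + n).  For fixed ends s, t the middle edges of light paths form a bipartite graph
-- of maximum degree ≤ p without a matching of size p, hence with at most 2p² edges.
-- Summing over s, t gives e³ ≤ 512 p² (mn)².

module Submission where

open import Data.Nat
  using (ℕ; zero; suc; _+_; _*_; _∸_; _^_; _≤_; _<_; z≤n; s≤s; s≤s⁻¹; _≤?_; _<?_; NonZero; >-nonZero)
open import Data.Nat.Properties hiding (_≟_)
open import Data.Bool using (Bool; true; false; T; if_then_else_)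
open import Data.Fin using (Fin; zero; suc)
open import Data.Fin.Properties using (_≟_; any?)
open import Data.Sum using (_⊎_; inj₁; inj₂; swap)
open import Data.Sum.Properties using (inj₁-injective; inj₂-injective; swap-involutive)
open import Data.Product using (_×_; _,_; proj₁; proj₂; ∃; ∃₂)
open import Data.Empty using (⊥-elim)
open import Data.List using (tabulate; allFin) renaming (map to mapList)
open import Data.List.Properties using (map-tabulate)
open import Data.Nat.ListAction using () renaming (sum to sumList)
open import Function using (_∘_; id)
open import Function.Definitions using (Injective)
open import Relation.Nullary using (¬_; Dec; yes; no; does; _×-dec_; _⊎-dec_; ¬?)
open import Relation.Nullary.Decidable using (T?; dec-true; map′)
open import Relation.Binary.PropositionalEquality
open import Algebra.Properties.Semiring.Sum +-*-semiring
  using (sum; sum-syntax; ∑-distrib-+; ∑-comm; *-distribˡ-sum; *-distribʳ-sum; sum-cong-≗; sum-replicate-zero)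
open import Data.Nat.Tactic.RingSolver using (solve-∀)
open import Defs using (BipGraph; edges; Adj; ContainsTheta; ThetaV; ThetaE)

∑-mono-≤ : ∀ {n} {f g : Fin n → ℕ} → (∀ i → f i ≤ g i) → sum f ≤ sum g
∑-mono-≤ {zero}  f≤g = z≤n
∑-mono-≤ {suc n} f≤g = +-mono-≤ (f≤g zero) (∑-mono-≤ (f≤g ∘ suc))

∑-const : ∀ n c → ∑[ i < n ] c ≡ n * c
∑-const zero    c = refl
∑-const (suc n) c = cong (c +_) (∑-const n c)

∑-positive : ∀ {n} (f : Fin n → ℕ) → 0 < sum f → ∃ λ i → 0 < f i
∑-positive {suc n} f pos with f zero in eq
... | suc _ = zero , subst (0 <_) (sym eq) (s≤s z≤n)
... | zero with ∑-positive (f ∘ suc) pos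
...   | i , fi>0 = suc i , fi>0

∑-except : ∀ {n} (f : Fin n → ℕ) k → sum f ≡ f k + ∑[ i < n ] (if does (i ≟ k) then 0 else f i)
∑-except {suc n} f zero    = refl
∑-except {suc n} f (suc k) = begin
  f zero + sum (f ∘ suc)                  ≡⟨ cong (f zero +_) (∑-except (f ∘ suc) k) ⟩
  f zero + (f (suc k) + rest)             ≡⟨ +-comm-middle (f zero) (f (suc k)) rest ⟩
  f (suc k) + (f zero + rest)             ∎
  where
  open ≡-Reasoning
  rest = ∑[ i < n ] (if does (i ≟ k) then 0 else f (suc i))
  +-comm-middle : ∀ a b c → a + (b + c) ≡ b + (a + c)
  +-comm-middle = solve-∀

∑∑-comm : ∀ {m n k l} (f : Fin m → Fin n → Fin k → Fin l → ℕ) →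
  ∑[ i < m ] ∑[ j < n ] ∑[ a < k ] ∑[ b < l ] f i j a b ≡
  ∑[ a < k ] ∑[ b < l ] ∑[ i < m ] ∑[ j < n ] f i j a b
∑∑-comm {m} {n} {k} {l} f = begin
  ∑[ i < m ] ∑[ j < n ] ∑[ a < k ] ∑[ b < l ] f i j a b
    ≡⟨ sum-cong-≗ (λ i → ∑-comm (λ j a → ∑[ b < l ] f i j a b)) ⟩
  ∑[ i < m ] ∑[ a < k ] ∑[ j < n ] ∑[ b < l ] f i j a b
    ≡⟨ ∑-comm (λ i a → ∑[ j < n ] ∑[ b < l ] f i j a b) ⟩
  ∑[ a < k ] ∑[ i < m ] ∑[ j < n ] ∑[ b < l ] f i j a b
    ≡⟨ sum-cong-≗ (λ a → sum-cong-≗ (λ i → ∑-comm (λ j b → f i j a b))) ⟩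
  ∑[ a < k ] ∑[ i < m ] ∑[ b < l ] ∑[ j < n ] f i j a b
    ≡⟨ sum-cong-≗ (λ a → ∑-comm (λ i b → ∑[ j < n ] f i j a b)) ⟩
  ∑[ a < k ] ∑[ b < l ] ∑[ i < m ] ∑[ j < n ] f i j a b
    ∎
  where open ≡-Reasoning

∑∑-*ˡ : ∀ {m n} c (f : Fin m → Fin n → ℕ) →
        ∑[ i < m ] ∑[ j < n ] (c * f i j) ≡ c * (∑[ i < m ] ∑[ j < n ] f i j)
∑∑-*ˡ {m} {n} c f =
  sym (trans (*-distribˡ-sum c (λ i → ∑[ j < n ] f i j)) (sum-cong-≗ (λ i → *-distribˡ-sum c (f i))))

sum-tabulate : ∀ {n} (f : Fin n → ℕ) → sumList (tabulate f) ≡ sum f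
sum-tabulate {zero}  f = refl
sum-tabulate {suc n} f = cong (f zero +_) (sum-tabulate (f ∘ suc))

sum-allFin : ∀ {n} (f : Fin n → ℕ) → sumList (mapList f (allFin n)) ≡ sum f
sum-allFin {n} f = trans (cong sumList (map-tabulate id f)) (sum-tabulate f)

indicator : Bool → ℕ
indicator b = if b then 1 else 0

indicator≤1 : ∀ b → indicator b ≤ 1
indicator≤1 false = z≤n
indicator≤1 true  = ≤-refl

-- Opaque, so that the decision procedure P? is recovered from count P? by unification.
opaque
  count : ∀ {n} {P : Fin n → Set} → (∀ i → Dec (P i)) → ℕ
  count {n} P? = ∑[ i < n ] indicator (does (P? i))

  count₂ : ∀ {m n} {R : Fin m → Fin n → Set} → (∀ i j → Dec (R i j)) → ℕ
  count₂ {m} R? = ∑[ i < m ] count (R? i)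

opaque
  unfolding count

  count-mono : ∀ {n} {P Q : Fin n → Set} {P? : ∀ i → Dec (P i)} {Q? : ∀ i → Dec (Q i)} →
               (∀ i → P i → Q i) → count P? ≤ count Q?
  count-mono {P? = P?} {Q?} P⇒Q = ∑-mono-≤ pointwise
    where
    pointwise : ∀ i → indicator (does (P? i)) ≤ indicator (does (Q? i))
    pointwise i with P? i | Q? i
    ... | no _  | _     = z≤n
    ... | yes _ | yes _ = ≤-refl
    ... | yes p | no ¬q = ⊥-elim (¬q (P⇒Q i p))

  count-⊎ : ∀ {n} {P Q : Fin n → Set} (P? : ∀ i → Dec (P i)) (Q? : ∀ i → Dec (Q i)) →
            count (λ i → P? i ⊎-dec Q? i) ≤ count P? + count Q?
  count-⊎ P? Q? = ≤-trans (∑-mono-≤ pointwise)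
    (≤-reflexive (∑-distrib-+ (λ i → indicator (does (P? i))) (λ i → indicator (does (Q? i)))))
    where
    pointwise : ∀ i → indicator (does (P? i ⊎-dec Q? i)) ≤ indicator (does (P? i)) + indicator (does (Q? i))
    pointwise i with P? i | Q? i
    ... | yes _ | _     = s≤s z≤n
    ... | no _  | yes _ = s≤s z≤n
    ... | no _  | no _  = z≤n

count-cong : ∀ {n} {P Q : Fin n → Set} {P? : ∀ i → Dec (P i)} {Q? : ∀ i → Dec (Q i)} →
             (∀ i → P i → Q i) → (∀ i → Q i → P i) → count P? ≡ count Q?
count-cong P⇒Q Q⇒P = ≤-antisym (count-mono P⇒Q) (count-mono Q⇒P)

module _ {n : ℕ} {P : Fin n → Set} (P? : ∀ i → Dec (P i)) where
  opaque
    unfolding count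

    count-≤ : count P? ≤ n
    count-≤ = ≤-trans (∑-mono-≤ (λ i → indicator≤1 (does (P? i))))
                      (≤-reflexive (trans (∑-const n 1) (*-identityʳ n)))

    count-empty : (∀ i → ¬ P i) → count P? ≡ 0
    count-empty none = trans (sum-cong-≗ pointwise) (sum-replicate-zero n)
      where
      pointwise : ∀ i → indicator (does (P? i)) ≡ 0
      pointwise i with P? i
      ... | yes p = ⊥-elim (none i p)
      ... | no _  = refl

    count-positive : 0 < count P? → ∃ P
    count-positive pos with ∑-positive _ pos
    ... | i , ind>0 with P? i
    ...   | yes p = i , p

    count-except : ∀ k → count P? ≡ indicator (does (P? k)) + count (λ i → P? i ×-dec ¬? (i ≟ k))
    count-except k = trans (∑-except _ k) (cong (_ +_) (sum-cong-≗ pointwise))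
      where
      pointwise : ∀ i → (if does (i ≟ k) then 0 else indicator (does (P? i)))
                        ≡ indicator (does (P? i ×-dec ¬? (i ≟ k)))
      pointwise i with i ≟ k | P? i
      ... | yes _ | yes _ = refl
      ... | yes _ | no _  = refl
      ... | no _  | yes _ = refl
      ... | no _  | no _  = refl

  count-except-≤ : ∀ k → count P? ≤ suc (count (λ i → P? i ×-dec ¬? (i ≟ k)))
  count-except-≤ k = ≤-trans (≤-reflexive (count-except k)) (+-monoˡ-≤ _ (indicator≤1 (does (P? k))))

  count-except-member : ∀ {k} → P k → count P? ≡ suc (count (λ i → P? i ×-dec ¬? (i ≟ k)))
  count-except-member {k} p =
    trans (count-except k) (cong (λ b → indicator b + count (λ i → P? i ×-dec ¬? (i ≟ k))) (dec-true (P? k) p))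

  count-member : ∀ {k} → P k → 1 ≤ count P?
  count-member p = ≤-trans (s≤s z≤n) (≤-reflexive (sym (count-except-member p)))

count-guarded : ∀ {n} {P Q : Fin n → Set} {C : Set} {P? : ∀ i → Dec (P i)} {Q? : ∀ i → Dec (Q i)} {k} →
                (∀ i → P i → Q i × C) → (C → count Q? ≤ k) → count P? ≤ k
count-guarded {P? = P?} {k = k} P⇒Q×C bound with count P? in eq
... | zero  = z≤n
... | suc _ with count-positive P? (subst (0 <_) (sym eq) (s≤s z≤n))
...   | i , pᵢ =
  subst (_≤ k) eq (≤-trans (count-mono (λ j → proj₁ ∘ P⇒Q×C j)) (bound (proj₂ (P⇒Q×C i pᵢ))))

opaque
  unfolding count

  count₂-by-rows : ∀ {m n} {R : Fin m → Fin n → Set} (R? : ∀ i j → Dec (R i j)) →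
                   count₂ R? ≡ ∑[ i < m ] count (R? i)
  count₂-by-rows R? = refl

  count₂-mono : ∀ {m n} {R S : Fin m → Fin n → Set} {R? : ∀ i j → Dec (R i j)} {S? : ∀ i j → Dec (S i j)} →
                (∀ i j → R i j → S i j) → count₂ R? ≤ count₂ S?
  count₂-mono {R? = R?} {S?} R⇒S = ∑-mono-≤ (λ i → count-mono {P? = R? i} {Q? = S? i} (R⇒S i))

  count₂-⊎ : ∀ {m n} {R S : Fin m → Fin n → Set} (R? : ∀ i j → Dec (R i j)) (S? : ∀ i j → Dec (S i j)) →
             count₂ (λ i j → R? i j ⊎-dec S? i j) ≤ count₂ R? + count₂ S?
  count₂-⊎ R? S? = ≤-trans (∑-mono-≤ (λ i → count-⊎ (R? i) (S? i)))
                           (≤-reflexive (∑-distrib-+ (λ i → count (R? i)) (λ i → count (S? i))))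

  count₂-transpose : ∀ {m n} {R : Fin m → Fin n → Set} (R? : ∀ i j → Dec (R i j)) →
                     count₂ (λ j i → R? i j) ≡ count₂ R?
  count₂-transpose R? = ∑-comm (λ j i → indicator (does (R? i j)))

  count₂-×-dec : ∀ {m n} {P : Fin m → Set} {Q : Fin n → Set} (P? : ∀ i → Dec (P i)) (Q? : ∀ j → Dec (Q j)) →
                 count₂ (λ i j → P? i ×-dec Q? j) ≡ count P? * count Q?
  count₂-×-dec {m} {n} P? Q? = trans (sum-cong-≗ row) (sym (*-distribʳ-sum (count Q?) (λ i → indicator (does (P? i)))))
    where
    row : ∀ i → count (λ j → P? i ×-dec Q? j) ≡ indicator (does (P? i)) * count Q?
    row i with does (P? i)
    ... | true  = sym (+-identityʳ _)
    ... | false = sum-replicate-zero n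

  count₂-comm : ∀ {m n k l} {R : Fin m → Fin n → Fin k → Fin l → Set} (R? : ∀ i j a b → Dec (R i j a b)) →
                ∑[ i < m ] ∑[ j < n ] count₂ (R? i j) ≡ ∑[ a < k ] ∑[ b < l ] count₂ (λ i j → R? i j a b)
  count₂-comm R? = ∑∑-comm (λ i j a b → indicator (does (R? i j a b)))

  count₂-weighted : ∀ {m n} {R : Fin m → Fin n → Set} (R? : ∀ i j → Dec (R i j)) {c}
                    (f : Fin m → Fin n → ℕ) →
                    (∀ i j → R i j → c ≤ f i j) → count₂ R? * c ≤ ∑[ i < m ] ∑[ j < n ] f i j
  count₂-weighted {m} {n} R? {c} f R⇒c≤f = begin
    (∑[ i < m ] ∑[ j < n ] indicator (does (R? i j))) * c
      ≡⟨ *-distribʳ-sum c (λ i → ∑[ j < n ] indicator (does (R? i j))) ⟩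
    ∑[ i < m ] ((∑[ j < n ] indicator (does (R? i j))) * c)
      ≡⟨ sum-cong-≗ (λ i → *-distribʳ-sum c (λ j → indicator (does (R? i j)))) ⟩
    ∑[ i < m ] ∑[ j < n ] (indicator (does (R? i j)) * c)
      ≤⟨ ∑-mono-≤ (λ i → ∑-mono-≤ (pointwise i)) ⟩
    ∑[ i < m ] ∑[ j < n ] f i j
      ∎
    where
    open ≤-Reasoning
    pointwise : ∀ i j → indicator (does (R? i j)) * c ≤ f i j
    pointwise i j with R? i j
    ... | yes r = ≤-trans (≤-reflexive (+-identityʳ c)) (R⇒c≤f i j r)
    ... | no _  = z≤n

infix 4 _⊆_

_⊆_ : ∀ {m n} → BipGraph m n → BipGraph m n → Set
H ⊆ G = ∀ i j → T (H i j) → T (G i j)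

transpose : ∀ {m n} → BipGraph m n → BipGraph n m
transpose G j i = G i j

degA : ∀ {m n} → BipGraph m n → Fin m → ℕ
degA G i = count (λ j → T? (G i j))

degB : ∀ {m n} → BipGraph m n → Fin n → ℕ
degB G = degA (transpose G)

edgeCount : ∀ {m n} → BipGraph m n → ℕ
edgeCount G = count₂ (λ i j → T? (G i j))

activeA : ∀ {m n} → BipGraph m n → ℕ
activeA G = count (λ i → 1 ≤? degA G i)

activeB : ∀ {m n} → BipGraph m n → ℕ
activeB G = activeA (transpose G)

activeA-≤ : ∀ {m n} (G : BipGraph m n) → activeA G ≤ m
activeA-≤ G = count-≤ (λ i → 1 ≤? degA G i)

activeB-≤ : ∀ {m n} (G : BipGraph m n) → activeB G ≤ n
activeB-≤ G = activeA-≤ (transpose G)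

graphOf : ∀ {m n} {R : Fin m → Fin n → Set} → (∀ i j → Dec (R i j)) → BipGraph m n
graphOf R? i j = does (R? i j)

module _ {m n : ℕ} {R : Fin m → Fin n → Set} (R? : ∀ i j → Dec (R i j)) where
  graphOf-sound : ∀ {i j} → T (graphOf R? i j) → R i j
  graphOf-sound {i} {j} h with R? i j
  ... | yes r = r

  graphOf-complete : ∀ {i j} → R i j → T (graphOf R? i j)
  graphOf-complete {i} {j} r with R? i j
  ... | yes _ = _
  ... | no ¬r = ¬r r

module _ {m n : ℕ} {H G : BipGraph m n} (H⊆G : H ⊆ G) where
  degA-mono : ∀ i → degA H i ≤ degA G i
  degA-mono i = count-mono (H⊆G i)

  degB-mono : ∀ j → degB H j ≤ degB G j
  degB-mono j = count-mono (λ i → H⊆G i j)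

edgeCount-transpose : ∀ {m n} (G : BipGraph m n) → edgeCount (transpose G) ≡ edgeCount G
edgeCount-transpose G = count₂-transpose (λ i j → T? (G i j))

edge⇒degA-positive : ∀ {m n} (G : BipGraph m n) {i j} → T (G i j) → 1 ≤ degA G i
edge⇒degA-positive G ij = count-member (λ j → T? (G _ j)) ij

edgeCount-positive : ∀ {m n} (G : BipGraph m n) → 0 < edgeCount G → ∃₂ λ i j → T (G i j)
edgeCount-positive G pos with ∑-positive (degA G) (subst (0 <_) (count₂-by-rows (λ i j → T? (G i j))) pos)
... | i , deg>0 with count-positive (λ j → T? (G i j)) deg>0
...   | j , ij = i , j , ij

opaque
  unfolding count

  edges≡edgeCount : ∀ {m n} (G : BipGraph m n) → edges G ≡ edgeCount G
  edges≡edgeCount {m} {n} G =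
    trans (sum-allFin (λ i → sumList (mapList (λ j → indicator (G i j)) (allFin n))))
          (sum-cong-≗ (λ i → sum-allFin (λ j → indicator (G i j))))

deleteRow : ∀ {m n} → BipGraph m n → Fin m → BipGraph m n
deleteRow G i₀ = graphOf (λ i j → T? (G i j) ×-dec ¬? (i ≟ i₀))

deleteCol : ∀ {m n} → BipGraph m n → Fin n → BipGraph m n
deleteCol G j₀ = transpose (deleteRow (transpose G) j₀)

module _ {m n : ℕ} (G : BipGraph m n) (i₀ : Fin m) where
  deleteRow-sound : ∀ {i j} → T (deleteRow G i₀ i j) → T (G i j) × i ≢ i₀
  deleteRow-sound = graphOf-sound (λ i j → T? (G i j) ×-dec ¬? (i ≟ i₀))

  deleteRow-complete : ∀ {i j} → T (G i j) → i ≢ i₀ → T (deleteRow G i₀ i j)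
  deleteRow-complete ij i≢i₀ = graphOf-complete (λ i j → T? (G i j) ×-dec ¬? (i ≟ i₀)) (ij , i≢i₀)

  deleteRow-⊆ : deleteRow G i₀ ⊆ G
  deleteRow-⊆ _ _ ij = proj₁ (deleteRow-sound ij)

  edgeCount-deleteRow : edgeCount G ≡ degA G i₀ + edgeCount (deleteRow G i₀)
  edgeCount-deleteRow = begin
    edgeCount G                                          ≡⟨ count₂-by-rows _ ⟩
    ∑[ i < m ] degA G i                                  ≡⟨ ∑-except (degA G) i₀ ⟩
    degA G i₀ + (∑[ i < m ] (if does (i ≟ i₀) then 0 else degA G i))
                                                         ≡⟨ cong (degA G i₀ +_) (sum-cong-≗ (λ i → row i (i ≟ i₀))) ⟩
    degA G i₀ + (∑[ i < m ] degA (deleteRow G i₀) i)    ≡⟨ cong (degA G i₀ +_) (count₂-by-rows _) ⟨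
    degA G i₀ + edgeCount (deleteRow G i₀)               ∎
    where
    open ≡-Reasoning
    row : ∀ i (i≟i₀ : Dec (i ≡ i₀)) → (if does i≟i₀ then 0 else degA G i) ≡ degA (deleteRow G i₀) i
    row i (yes i≡i₀) = sym (count-empty _ (λ j ij → proj₂ (deleteRow-sound {i} {j} ij) i≡i₀))
    row i (no i≢i₀)  = count-cong (λ j ij → deleteRow-complete {i} {j} ij i≢i₀)
                                  (λ j → proj₁ ∘ deleteRow-sound {i} {j})

  activeA-deleteRow : 1 ≤ degA G i₀ → suc (activeA (deleteRow G i₀)) ≤ activeA G
  activeA-deleteRow active = begin
    suc (activeA (deleteRow G i₀))
      ≤⟨ s≤s (count-mono still-active) ⟩
    suc (count (λ i → (1 ≤? degA G i) ×-dec ¬? (i ≟ i₀)))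
      ≡⟨ count-except-member (λ i → 1 ≤? degA G i) active ⟨
    activeA G
      ∎
    where
    open ≤-Reasoning
    still-active : ∀ i → 1 ≤ degA (deleteRow G i₀) i → 1 ≤ degA G i × i ≢ i₀
    still-active i pos with count-positive (λ j → T? (deleteRow G i₀ i j)) pos
    ... | _ , ij = ≤-trans pos (degA-mono deleteRow-⊆ i) , proj₂ (deleteRow-sound ij)

  activeB-deleteRow : activeB (deleteRow G i₀) ≤ activeB G
  activeB-deleteRow = count-mono (λ j pos → ≤-trans pos (degB-mono deleteRow-⊆ j))

module _ {m n : ℕ} (G : BipGraph m n) (j₀ : Fin n) where
  deleteCol-sound : ∀ {i j} → T (deleteCol G j₀ i j) → T (G i j) × j ≢ j₀
  deleteCol-sound = deleteRow-sound (transpose G) j₀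

  deleteCol-complete : ∀ {i j} → T (G i j) → j ≢ j₀ → T (deleteCol G j₀ i j)
  deleteCol-complete = deleteRow-complete (transpose G) j₀

  deleteCol-⊆ : deleteCol G j₀ ⊆ G
  deleteCol-⊆ i j = deleteRow-⊆ (transpose G) j₀ j i

  edgeCount-deleteCol : edgeCount G ≡ degB G j₀ + edgeCount (deleteCol G j₀)
  edgeCount-deleteCol = begin
    edgeCount G                                          ≡⟨ edgeCount-transpose G ⟨
    edgeCount (transpose G)                              ≡⟨ edgeCount-deleteRow (transpose G) j₀ ⟩
    degB G j₀ + edgeCount (transpose (deleteCol G j₀))
      ≡⟨ cong (degB G j₀ +_) (edgeCount-transpose (deleteCol G j₀)) ⟩
    degB G j₀ + edgeCount (deleteCol G j₀)               ∎
    where open ≡-Reasoning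

  activeB-deleteCol : 1 ≤ degB G j₀ → suc (activeB (deleteCol G j₀)) ≤ activeB G
  activeB-deleteCol = activeA-deleteRow (transpose G) j₀

  activeA-deleteCol : activeA (deleteCol G j₀) ≤ activeA G
  activeA-deleteCol = activeB-deleteRow (transpose G) j₀

deleteVertices : ∀ {m n} → BipGraph m n → Fin m → Fin n → BipGraph m n
deleteVertices G i₀ j₀ = deleteRow (deleteCol G j₀) i₀

module _ {m n : ℕ} (G : BipGraph m n) (i₀ : Fin m) (j₀ : Fin n) where
  deleteVertices-sound : ∀ {i j} → T (deleteVertices G i₀ j₀ i j) → T (G i j) × i ≢ i₀ × j ≢ j₀
  deleteVertices-sound ij with deleteRow-sound (deleteCol G j₀) i₀ ij
  ... | ij′ , i≢i₀ = proj₁ (deleteCol-sound G j₀ ij′) , i≢i₀ , proj₂ (deleteCol-sound G j₀ ij′)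

  deleteVertices-⊆ : deleteVertices G i₀ j₀ ⊆ G
  deleteVertices-⊆ _ _ = proj₁ ∘ deleteVertices-sound

  edgeCount-deleteVertices : edgeCount G ≤ degA G i₀ + degB G j₀ + edgeCount (deleteVertices G i₀ j₀)
  edgeCount-deleteVertices = begin
    edgeCount G
      ≡⟨ edgeCount-deleteCol G j₀ ⟩
    degB G j₀ + edgeCount (deleteCol G j₀)
      ≡⟨ cong (degB G j₀ +_) (edgeCount-deleteRow (deleteCol G j₀) i₀) ⟩
    degB G j₀ + (degA (deleteCol G j₀) i₀ + edgeCount (deleteVertices G i₀ j₀))
      ≤⟨ +-monoʳ-≤ (degB G j₀) (+-monoˡ-≤ _ (degA-mono (deleteCol-⊆ G j₀) i₀)) ⟩
    degB G j₀ + (degA G i₀ + edgeCount (deleteVertices G i₀ j₀))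
      ≡⟨ +-comm-middle (degB G j₀) (degA G i₀) _ ⟩
    degA G i₀ + degB G j₀ + edgeCount (deleteVertices G i₀ j₀)
      ∎
    where
    open ≤-Reasoning
    +-comm-middle : ∀ a b c → a + (b + c) ≡ b + a + c
    +-comm-middle = solve-∀

  degA-deleteVertices : ∀ {i} → i ≢ i₀ → degA G i ≤ suc (degA (deleteVertices G i₀ j₀) i)
  degA-deleteVertices {i} i≢i₀ = ≤-trans (count-except-≤ (λ j → T? (G i j)) j₀) (s≤s (count-mono kept))
    where
    kept : ∀ j → T (G i j) × j ≢ j₀ → T (deleteVertices G i₀ j₀ i j)
    kept j (ij , j≢j₀) = deleteRow-complete (deleteCol G j₀) i₀ (deleteCol-complete G j₀ ij j≢j₀) i≢i₀

-- Matchings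

record Matching {m n} (k : ℕ) (G : BipGraph m n) : Set where
  field
    row           : Fin k → Fin m
    col           : Fin k → Fin n
    row-injective : Injective _≡_ _≡_ row
    col-injective : Injective _≡_ _≡_ col
    matched       : ∀ r → T (G (row r) (col r))

Matching-⊆ : ∀ {m n k} {H G : BipGraph m n} → H ⊆ G → Matching k H → Matching k G
Matching-⊆ H⊆G M = record
  { row = row ; col = col ; row-injective = row-injective ; col-injective = col-injective
  ; matched = λ r → H⊆G (row r) (col r) (matched r) }
  where open Matching M

emptyMatching : ∀ {m n} {G : BipGraph m n} → Matching 0 G
emptyMatching = record
  { row = λ () ; col = λ () ; row-injective = λ { {()} } ; col-injective = λ { {()} } ; matched = λ () }

Matching-extend : ∀ {m n k} {G : BipGraph m n} {i₀ j₀} → T (G i₀ j₀) →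
                  Matching k (deleteVertices G i₀ j₀) → Matching (suc k) G
Matching-extend {G = G} {i₀} {j₀} i₀j₀ M = record
  { row = row′ ; col = col′ ; row-injective = row′-injective ; col-injective = col′-injective ; matched = matched′ }
  where
  open Matching M
  avoids : ∀ r → T (G (row r) (col r)) × row r ≢ i₀ × col r ≢ j₀
  avoids r = deleteVertices-sound G i₀ j₀ (matched r)

  row′ : Fin (suc _) → Fin _
  row′ zero    = i₀
  row′ (suc r) = row r

  col′ : Fin (suc _) → Fin _
  col′ zero    = j₀
  col′ (suc r) = col r

  row′-injective : Injective _≡_ _≡_ row′
  row′-injective {zero}  {zero}  _ = refl
  row′-injective {zero}  {suc r} e = ⊥-elim (proj₁ (proj₂ (avoids r)) (sym e))
  row′-injective {suc r} {zero}  e = ⊥-elim (proj₁ (proj₂ (avoids r)) e)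
  row′-injective {suc r} {suc q} e = cong suc (row-injective e)

  col′-injective : Injective _≡_ _≡_ col′
  col′-injective {zero}  {zero}  _ = refl
  col′-injective {zero}  {suc r} e = ⊥-elim (proj₂ (proj₂ (avoids r)) (sym e))
  col′-injective {suc r} {zero}  e = ⊥-elim (proj₂ (proj₂ (avoids r)) e)
  col′-injective {suc r} {suc q} e = cong suc (col-injective e)

  matched′ : ∀ r → T (G (row′ r) (col′ r))
  matched′ zero    = i₀j₀
  matched′ (suc r) = proj₁ (avoids r)

module _ {m n : ℕ} (Invariant : ℕ → BipGraph m n → Set)
  (shrink : ∀ {k G} → Invariant (suc k) G →
            ∃₂ λ i j → T (G i j) × Invariant k (deleteVertices G i j)) where

  greedyMatching : ∀ k {G} → Invariant k G → Matching k G
  greedyMatching zero    _   = emptyMatching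
  greedyMatching (suc k) inv with shrink inv
  ... | _ , _ , ij , inv′ = Matching-extend ij (greedyMatching k inv′)

ManyHighDegreeRows : ∀ {m n} → ℕ → BipGraph m n → Set
ManyHighDegreeRows k G = k ≤ count (λ i → k ≤? degA G i)

matching-of-high-degree-rows : ∀ {m n} k (G : BipGraph m n) → ManyHighDegreeRows k G → Matching k G
matching-of-high-degree-rows {m} {n} k G = greedyMatching ManyHighDegreeRows shrink k
  where
  shrink : ∀ {k} {G : BipGraph m n} → ManyHighDegreeRows (suc k) G →
           ∃₂ λ i j → T (G i j) × ManyHighDegreeRows k (deleteVertices G i j)
  shrink {k} {G} many with count-positive (λ i → suc k ≤? degA G i) (≤-trans (s≤s z≤n) many)
  ... | i₀ , high with count-positive (λ j → T? (G i₀ j)) (≤-trans (s≤s z≤n) high)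
  ...   | j₀ , i₀j₀ = i₀ , j₀ , i₀j₀ , s≤s⁻¹ (begin
    suc k                                                      ≤⟨ many ⟩
    count (λ i → suc k ≤? degA G i)                            ≤⟨ count-except-≤ (λ i → suc k ≤? degA G i) i₀ ⟩
    suc (count (λ i → (suc k ≤? degA G i) ×-dec ¬? (i ≟ i₀)))  ≤⟨ s≤s (count-mono still-high) ⟩
    suc (count (λ i → k ≤? degA (deleteVertices G i₀ j₀) i))   ∎)
    where
    open ≤-Reasoning
    still-high : ∀ i → suc k ≤ degA G i × i ≢ i₀ → k ≤ degA (deleteVertices G i₀ j₀) i
    still-high i (high , i≢i₀) = s≤s⁻¹ (≤-trans high (degA-deleteVertices G i₀ j₀ i≢i₀))

record DegreeBoundedAndDense {m n} (D k : ℕ) (G : BipGraph m n) : Set where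
  constructor degreeBoundedAndDense
  field
    degA-bound : ∀ i → degA G i ≤ D
    degB-bound : ∀ j → degB G j ≤ D
    dense      : k * (D + D) < edgeCount G

matching-of-bounded-degree : ∀ {m n} D k (G : BipGraph m n) → DegreeBoundedAndDense D k G → Matching k G
matching-of-bounded-degree {m} {n} D k G = greedyMatching (DegreeBoundedAndDense D) shrink k
  where
  shrink : ∀ {k} {G : BipGraph m n} → DegreeBoundedAndDense D (suc k) G →
           ∃₂ λ i j → T (G i j) × DegreeBoundedAndDense D k (deleteVertices G i j)
  shrink {k} {G} (degreeBoundedAndDense boundA boundB dense) with edgeCount-positive G (≤-trans (s≤s z≤n) dense)
  ... | i₀ , j₀ , i₀j₀ = i₀ , j₀ , i₀j₀ , degreeBoundedAndDense
    (λ i → ≤-trans (degA-mono (deleteVertices-⊆ G i₀ j₀) i) (boundA i))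
    (λ j → ≤-trans (degB-mono (deleteVertices-⊆ G i₀ j₀) j) (boundB j))
    (+-cancelˡ-< (D + D) _ _ (begin-strict
      D + D + k * (D + D)                                         <⟨ dense ⟩
      edgeCount G                                                 ≤⟨ edgeCount-deleteVertices G i₀ j₀ ⟩
      degA G i₀ + degB G j₀ + edgeCount (deleteVertices G i₀ j₀)
        ≤⟨ +-monoˡ-≤ _ (+-mono-≤ (boundA i₀) (boundB j₀)) ⟩
      D + D + edgeCount (deleteVertices G i₀ j₀)                  ∎))
    where open ≤-Reasoning

-- Copies of θ_{3,p}

Adj-mono : ∀ {m n} {H G : BipGraph m n} → H ⊆ G → ∀ u v → Adj H u v → Adj G u v
Adj-mono H⊆G (inj₁ i) (inj₂ j) = H⊆G i j
Adj-mono H⊆G (inj₂ j) (inj₁ i) = H⊆G i j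

ContainsTheta-mono : ∀ {m n} p {H G : BipGraph m n} → H ⊆ G → ContainsTheta p H → ContainsTheta p G
ContainsTheta-mono p H⊆G (f , f-injective , f-edges) =
  f , f-injective , λ x y e → Adj-mono H⊆G (f x) (f y) (f-edges x y e)

Adj-transpose : ∀ {m n} (G : BipGraph m n) u v → Adj (transpose G) u v → Adj G (swap u) (swap v)
Adj-transpose G (inj₁ j) (inj₂ i) = id
Adj-transpose G (inj₂ i) (inj₁ j) = id

ContainsTheta-transpose : ∀ {m n} p (G : BipGraph m n) → ContainsTheta p (transpose G) → ContainsTheta p G
ContainsTheta-transpose p G (f , f-injective , f-edges) =
  swap ∘ f , f-injective ∘ swap-injective , λ x y e → Adj-transpose G (f x) (f y) (f-edges x y e)
  where
  swap-injective : ∀ {A B : Set} {u v : A ⊎ B} → swap u ≡ swap v → u ≡ v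
  swap-injective {u = u} {v} e = trans (sym (swap-involutive u)) (trans (cong swap e) (swap-involutive v))

record Path3 {m n} (G : BipGraph m n) (s : Fin m) (x : Fin n) (y : Fin m) (t : Fin n) : Set where
  constructor path3
  field
    sx  : T (G s x)
    yx  : T (G y x)
    yt  : T (G y t)
    s≢y : s ≢ y
    x≢t : x ≢ t

path3? : ∀ {m n} (G : BipGraph m n) s x y t → Dec (Path3 G s x y t)
path3? G s x y t = map′ (λ (sx , yx , yt , s≢y , x≢t) → path3 sx yx yt s≢y x≢t)
                        (λ (path3 sx yx yt s≢y x≢t) → sx , yx , yt , s≢y , x≢t)
                        (T? (G s x) ×-dec T? (G y x) ×-dec T? (G y t) ×-dec ¬? (s ≟ y) ×-dec ¬? (x ≟ t))

link : ∀ {m n} → BipGraph m n → Fin m → Fin n → BipGraph m n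
link G s t = graphOf (λ y x → path3? G s x y t)

ContainsTheta-of-link-matching : ∀ {m n p} (G : BipGraph m n) {s₀ t₀} →
                                 Matching p (link G s₀ t₀) → ContainsTheta p G
ContainsTheta-of-link-matching {m} {n} {p} G {s₀} {t₀} M = embed , embed-injective , embed-edges
  where
  open Matching M
  open ThetaV
  open ThetaE
  open Path3

  path : ∀ r → Path3 G s₀ (col r) (row r) t₀
  path r = graphOf-sound (λ y x → path3? G s₀ x y t₀) (matched r)

  embed : ThetaV p → Fin m ⊎ Fin n
  embed s     = inj₁ s₀
  embed t     = inj₂ t₀
  embed (a r) = inj₂ (col r)
  embed (b r) = inj₁ (row r)

  embed-injective : Injective _≡_ _≡_ embed
  embed-injective {s}   {s}   _ = refl
  embed-injective {s}   {b r} e = ⊥-elim (s≢y (path r) (inj₁-injective e))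
  embed-injective {t}   {t}   _ = refl
  embed-injective {t}   {a r} e = ⊥-elim (x≢t (path r) (sym (inj₂-injective e)))
  embed-injective {a r} {t}   e = ⊥-elim (x≢t (path r) (inj₂-injective e))
  embed-injective {a r} {a q} e = cong a (col-injective (inj₂-injective e))
  embed-injective {b r} {s}   e = ⊥-elim (s≢y (path r) (sym (inj₁-injective e)))
  embed-injective {b r} {b q} e = cong b (row-injective (inj₁-injective e))
  embed-injective {s}   {t}   ()
  embed-injective {s}   {a _} ()
  embed-injective {t}   {s}   ()
  embed-injective {t}   {b _} ()
  embed-injective {a _} {s}   ()
  embed-injective {a _} {b _} ()
  embed-injective {b _} {t}   ()
  embed-injective {b _} {a _} ()

  embed-edges : ∀ u v → ThetaE u v → Adj G (embed u) (embed v)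
  embed-edges _ _ (sa r) = sx (path r)
  embed-edges _ _ (as r) = sx (path r)
  embed-edges _ _ (ab r) = yx (path r)
  embed-edges _ _ (ba r) = yx (path r)
  embed-edges _ _ (bt r) = yt (path r)
  embed-edges _ _ (tb r) = yt (path r)

codegA : ∀ {m n} → BipGraph m n → Fin m → Fin m → ℕ
codegA G s y = count (λ x → T? (G s x) ×-dec T? (G y x))

codegB : ∀ {m n} → BipGraph m n → Fin n → Fin n → ℕ
codegB G = codegA (transpose G)

-- p such vertices s, each with p common neighbours x′ ≠ x of y, give p paths y – x′ – s – x
-- with distinct middle vertices: a copy of θ_{3,p} with ends y and x.
few-heavy-partners : ∀ {m n} p (G : BipGraph m n) → ¬ ContainsTheta p G →
                     ∀ y x → count (λ s → T? (G s x) ×-dec ¬? (s ≟ y) ×-dec p <? codegA G s y) < p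
few-heavy-partners p G free y x = ≰⇒> λ many →
  free (ContainsTheta-of-link-matching G
         (matching-of-high-degree-rows p (link G y x) (≤-trans many (count-mono high-degree))))
  where
  high-degree : ∀ s → T (G s x) × s ≢ y × p < codegA G s y → p ≤ degA (link G y x) s
  high-degree s (sx , s≢y , heavy) = s≤s⁻¹ (begin
    suc p                                                                   ≤⟨ heavy ⟩
    codegA G s y                                                            ≤⟨ count-except-≤ _ x ⟩
    suc (count (λ x′ → (T? (G s x′) ×-dec T? (G y x′)) ×-dec ¬? (x′ ≟ x)))  ≤⟨ s≤s (count-mono link-path) ⟩
    suc (degA (link G y x) s)                                               ∎)
    where
    open ≤-Reasoning
    link-path : ∀ x′ → (T (G s x′) × T (G y x′)) × x′ ≢ x → T (link G y x s x′)
    link-path x′ ((sx′ , yx′) , x′≢x) =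
      graphOf-complete (λ y x → path3? G _ x y _) (path3 yx′ sx′ sx (≢-sym s≢y) x′≢x)

*-≤-pred*pred+ : ∀ a b → a * b ≤ (a ∸ 1) * (b ∸ 1) + a + b
*-≤-pred*pred+ zero    b       = z≤n
*-≤-pred*pred+ (suc a) zero    = ≤-trans (≤-reflexive (*-zeroʳ (suc a))) z≤n
*-≤-pred*pred+ (suc a) (suc b) = ≤-trans (n≤1+n _) (≤-reflexive (expand a b))
  where
  expand : ∀ a b → suc (suc a * suc b) ≡ a * b + suc a + suc b
  expand = solve-∀

light-paths-dominate : ∀ {a b p J} → 1 ≤ p → 16 * p ≤ a → 16 * p ≤ b →
                       (a ∸ 1) * (b ∸ 1) ≤ p * b + a * p + J → a * b ≤ 8 * J
light-paths-dominate {a} {b} {p} {J} 1≤p 16p≤a 16p≤b paths = ≤-trans (m≤n*m (a * b) 6) six-ab≤8J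
  where
  8[1+p]≤16p : 8 * suc p ≤ 16 * p
  8[1+p]≤16p = ≤-trans (≤-reflexive (*-suc 8 p)) (≤-trans (+-monoˡ-≤ (8 * p) (*-monoʳ-≤ 8 1≤p))
                                                        (≤-reflexive (double p)))
    where
    double : ∀ p → 8 * p + 8 * p ≡ 16 * p
    double = solve-∀
  six-ab≤8J : 6 * (a * b) ≤ 8 * J
  six-ab≤8J = +-cancelʳ-≤ (a * b + a * b) _ _ (begin
    6 * (a * b) + (a * b + a * b)                    ≡⟨ regroup₁ a b ⟩
    8 * (a * b)                                      ≤⟨ *-monoʳ-≤ 8 (*-≤-pred*pred+ a b) ⟩
    8 * ((a ∸ 1) * (b ∸ 1) + a + b)                  ≤⟨ *-monoʳ-≤ 8 (+-monoˡ-≤ b (+-monoˡ-≤ a paths)) ⟩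
    8 * (p * b + a * p + J + a + b)                  ≡⟨ regroup₂ a b p J ⟩
    8 * suc p * b + a * (8 * suc p) + 8 * J
      ≤⟨ +-monoˡ-≤ (8 * J) (+-mono-≤ (*-monoˡ-≤ b (≤-trans 8[1+p]≤16p 16p≤a))
                                     (*-monoʳ-≤ a (≤-trans 8[1+p]≤16p 16p≤b))) ⟩
    a * b + a * b + 8 * J                            ≡⟨ +-comm (a * b + a * b) (8 * J) ⟩
    8 * J + (a * b + a * b)                          ∎)
    where
    open ≤-Reasoning
    regroup₁ : ∀ a b → 6 * (a * b) + (a * b + a * b) ≡ 8 * (a * b)
    regroup₁ = solve-∀
    regroup₂ : ∀ a b p J → 8 * (p * b + a * p + J + a + b) ≡ 8 * suc p * b + a * (8 * suc p) + 8 * J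
    regroup₂ = solve-∀

cross-≤-trans : ∀ {a a′ a″ c c′ c″} → a + c′ ≤ a′ + c → a′ + c″ ≤ a″ + c′ → a + c″ ≤ a″ + c
cross-≤-trans {a} {a′} {a″} {c} {c′} {c″} h h′ = +-cancelʳ-≤ (a′ + c′) _ _ (begin
  a + c″ + (a′ + c′)      ≡⟨ swap-middle a c″ a′ c′ ⟩
  a + c′ + (a′ + c″)      ≤⟨ +-mono-≤ h h′ ⟩
  a′ + c + (a″ + c′)      ≡⟨ rotate a′ c a″ c′ ⟩
  a″ + c + (a′ + c′)      ∎)
  where
  open ≤-Reasoning
  swap-middle : ∀ a c″ a′ c′ → a + c″ + (a′ + c′) ≡ a + c′ + (a′ + c″)
  swap-middle = solve-∀
  rotate : ∀ a′ c a″ c′ → a′ + c + (a″ + c′) ≡ a″ + c + (a′ + c′)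
  rotate = solve-∀

degree-above-threshold : ∀ k p {d E} .{{_ : NonZero k}} → 64 * p * k ≤ E → E ≤ 4 * k * d → 16 * p ≤ d
degree-above-threshold k p {d} dense heavy =
  *-cancelˡ-≤ 4 (*-cancelˡ-≤ k (begin
    k * (4 * (16 * p))   ≡⟨ regroup₁ k p ⟩
    64 * p * k           ≤⟨ ≤-trans dense heavy ⟩
    4 * k * d            ≡⟨ regroup₂ k d ⟩
    k * (4 * d)          ∎))
  where
  open ≤-Reasoning
  regroup₁ : ∀ k p → k * (4 * (16 * p)) ≡ 64 * p * k
  regroup₁ = solve-∀
  regroup₂ : ∀ k d → 4 * k * d ≡ k * (4 * d)
  regroup₂ = solve-∀

n≤n³ : ∀ n .{{_ : NonZero n}} → n ≤ n ^ 3
n≤n³ n = ≤-trans (≤-reflexive (sym (*-identityʳ n))) (^-monoʳ-≤ n {1} {3} (s≤s z≤n))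

64p≤144p³ : ∀ p .{{_ : NonZero p}} → 64 * p ≤ 144 * p ^ 3
64p≤144p³ p = *-mono-≤ (m≤m+n 64 80) (n≤n³ p)

512p²≤[144p³]³ : ∀ p .{{_ : NonZero p}} → 512 * (p * p) ≤ (144 * p ^ 3) ^ 3
512p²≤[144p³]³ p = begin
  512 * (p * p)          ≤⟨ *-monoˡ-≤ (p * p) (m≤m+n 512 20224) ⟩
  144 * 144 * (p * p)    ≡⟨ interchange 144 p ⟩
  144 * p * (144 * p)    ≤⟨ *-mono-≤ 144p≤X 144p≤X ⟩
  X * X                  ≤⟨ m≤m*n (X * X) X {{m*n≢0 144 (p ^ 3) {{_}} {{m^n≢0 p 3}}}} ⟩
  X * X * X              ≡⟨ cube X ⟩
  X ^ 3                  ∎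
  where
  open ≤-Reasoning
  X = 144 * p ^ 3
  144p≤X : 144 * p ≤ X
  144p≤X = *-monoʳ-≤ 144 (n≤n³ p)
  interchange : ∀ c p → c * c * (p * p) ≡ c * p * (c * p)
  interchange = solve-∀
  cube : ∀ x → x * x * x ≡ x * (x * (x * 1))
  cube = solve-∀

-- Light paths of length three

module ThetaFree {m n : ℕ} (p : ℕ) (G : BipGraph m n) (free : ¬ ContainsTheta p G) where

  Light : Fin m → Fin n → Fin m → Fin n → Set
  Light s t y x = Path3 G s x y t × ¬ (p < codegA G s y) × ¬ (p < codegB G t x)

  light? : ∀ s t y x → Dec (Light s t y x)
  light? s t y x = path3? G s x y t ×-dec ¬? (p <? codegA G s y) ×-dec ¬? (p <? codegB G t x)

  light : Fin m → Fin n → BipGraph m n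
  light s t = graphOf (light? s t)

  lightPaths : Fin m → Fin n → ℕ
  lightPaths y x = count₂ (λ s t → T? (light s t y x))

  light⊆link : ∀ s t → light s t ⊆ link G s t
  light⊆link s t y x yx = graphOf-complete (λ y x → path3? G s x y t) (proj₁ (graphOf-sound (light? s t) yx))

  light-degA : ∀ s t y → degA (light s t) y ≤ p
  light-degA s t y = count-guarded codegree ≮⇒≥
    where
    codegree : ∀ x → T (light s t y x) → (T (G s x) × T (G y x)) × ¬ (p < codegA G s y)
    codegree x yx with graphOf-sound (light? s t) yx
    ... | path , not-heavy , _ = (Path3.sx path , Path3.yx path) , not-heavy

  light-degB : ∀ s t x → degB (light s t) x ≤ p
  light-degB s t x = count-guarded codegree ≮⇒≥
    where
    codegree : ∀ y → T (light s t y x) → (T (G y t) × T (G y x)) × ¬ (p < codegB G t x)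
    codegree y yx with graphOf-sound (light? s t) yx
    ... | path , _ , not-heavy = (Path3.yt path , Path3.yx path) , not-heavy

  light-edgeCount : ∀ s t → edgeCount (light s t) ≤ p * (p + p)
  light-edgeCount s t = ≮⇒≥ λ dense →
    free (ContainsTheta-of-link-matching G (Matching-⊆ (light⊆link s t)
      (matching-of-bounded-degree p p (light s t)
        (degreeBoundedAndDense (light-degA s t) (light-degB s t) dense))))

  lightPaths-total : ∑[ y < m ] ∑[ x < n ] lightPaths y x ≤ m * n * (p * (p + p))
  lightPaths-total = begin
    ∑[ y < m ] ∑[ x < n ] lightPaths y x       ≡⟨ count₂-comm (λ y x s t → T? (light s t y x)) ⟩
    ∑[ s < m ] ∑[ t < n ] edgeCount (light s t) ≤⟨ ∑-mono-≤ (λ s → ∑-mono-≤ (light-edgeCount s)) ⟩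
    ∑[ s < m ] ∑[ t < n ] (p * (p + p))
      ≡⟨ trans (sum-cong-≗ {m} (λ s → ∑-const n (p * (p + p)))) (∑-const m (n * (p * (p + p)))) ⟩
    m * (n * (p * (p + p)))                     ≡⟨ *-assoc m n _ ⟨
    m * n * (p * (p + p))                       ∎
    where open ≤-Reasoning

  paths-lower : ∀ {y x} → T (G y x) → (degB G x ∸ 1) * (degA G y ∸ 1) ≤ count₂ (λ s t → path3? G s x y t)
  paths-lower {y} {x} yx = begin
    (degB G x ∸ 1) * (degA G y ∸ 1)
      ≤⟨ *-mono-≤ (∸-monoˡ-≤ 1 (count-except-≤ _ y)) (∸-monoˡ-≤ 1 (count-except-≤ _ x)) ⟩
    count (λ s → T? (G s x) ×-dec ¬? (s ≟ y)) * count (λ t → T? (G y t) ×-dec ¬? (t ≟ x))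
      ≡⟨ count₂-×-dec (λ s → T? (G s x) ×-dec ¬? (s ≟ y)) (λ t → T? (G y t) ×-dec ¬? (t ≟ x)) ⟨
    count₂ (λ s t → (T? (G s x) ×-dec ¬? (s ≟ y)) ×-dec (T? (G y t) ×-dec ¬? (t ≟ x)))
      ≤⟨ count₂-mono (λ s t ((sx , s≢y) , (yt , t≢x)) → path3 sx yx yt s≢y (≢-sym t≢x)) ⟩
    count₂ (λ s t → path3? G s x y t)
      ∎
    where open ≤-Reasoning

  paths-upper : ∀ y x → count₂ (λ s t → path3? G s x y t) ≤ p * degA G y + degB G x * p + lightPaths y x
  paths-upper y x = begin
    count₂ (λ s t → path3? G s x y t)
      ≤⟨ count₂-mono classify ⟩
    count₂ (λ s t → heavyA? s t ⊎-dec (heavyB? s t ⊎-dec T? (light s t y x)))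
      ≤⟨ count₂-⊎ heavyA? (λ s t → heavyB? s t ⊎-dec T? (light s t y x)) ⟩
    count₂ heavyA? + count₂ (λ s t → heavyB? s t ⊎-dec T? (light s t y x))
      ≤⟨ +-monoʳ-≤ (count₂ heavyA?) (count₂-⊎ heavyB? (λ s t → T? (light s t y x))) ⟩
    count₂ heavyA? + (count₂ heavyB? + lightPaths y x)
      ≡⟨ +-assoc (count₂ heavyA?) _ _ ⟨
    count₂ heavyA? + count₂ heavyB? + lightPaths y x
      ≤⟨ +-monoˡ-≤ (lightPaths y x) (+-mono-≤ heavyA-bound heavyB-bound) ⟩
    p * degA G y + degB G x * p + lightPaths y x
      ∎
    where
    open ≤-Reasoning
    heavyA? : ∀ s t → Dec (Path3 G s x y t × p < codegA G s y)
    heavyA? s t = path3? G s x y t ×-dec p <? codegA G s y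

    heavyB? : ∀ s t → Dec (Path3 G s x y t × p < codegB G t x)
    heavyB? s t = path3? G s x y t ×-dec p <? codegB G t x

    partnerA? : ∀ s → Dec (T (G s x) × s ≢ y × p < codegA G s y)
    partnerA? s = T? (G s x) ×-dec ¬? (s ≟ y) ×-dec p <? codegA G s y

    partnerB? : ∀ t → Dec (T (G y t) × t ≢ x × p < codegB G t x)
    partnerB? t = T? (G y t) ×-dec ¬? (t ≟ x) ×-dec p <? codegB G t x

    classify : ∀ s t → Path3 G s x y t →
               (Path3 G s x y t × p < codegA G s y) ⊎ ((Path3 G s x y t × p < codegB G t x) ⊎ T (light s t y x))
    classify s t path with p <? codegA G s y | p <? codegB G t x
    ... | yes heavy | _         = inj₁ (path , heavy)
    ... | no _      | yes heavy = inj₂ (inj₁ (path , heavy))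
    ... | no ¬hA    | no ¬hB    = inj₂ (inj₂ (graphOf-complete (light? s t) (path , ¬hA , ¬hB)))

    heavyA-bound : count₂ heavyA? ≤ p * degA G y
    heavyA-bound = begin
      count₂ heavyA?
        ≤⟨ count₂-mono (λ s t (path , heavy) → (Path3.sx path , Path3.s≢y path , heavy) , Path3.yt path) ⟩
      count₂ (λ s t → partnerA? s ×-dec T? (G y t))
        ≡⟨ count₂-×-dec partnerA? (λ t → T? (G y t)) ⟩
      count partnerA? * degA G y
        ≤⟨ *-monoˡ-≤ (degA G y) (<⇒≤ (few-heavy-partners p G free y x)) ⟩
      p * degA G y
        ∎

    heavyB-bound : count₂ heavyB? ≤ degB G x * p
    heavyB-bound = begin
      count₂ heavyB?
        ≤⟨ count₂-mono (λ s t (path , heavy) → Path3.sx path , (Path3.yt path , ≢-sym (Path3.x≢t path) , heavy)) ⟩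
      count₂ (λ s t → T? (G s x) ×-dec partnerB? t)
        ≡⟨ count₂-×-dec (λ s → T? (G s x)) partnerB? ⟩
      degB G x * count partnerB?
        ≤⟨ *-monoʳ-≤ (degB G x) (<⇒≤ (few-heavy-partners p (transpose G) (free ∘ ContainsTheta-transpose p G)
                                                           x y)) ⟩
      degB G x * p
        ∎

  edge-on-many-light-paths : 1 ≤ p → ∀ {y x} → T (G y x) → 16 * p ≤ degB G x → 16 * p ≤ degA G y →
                             degB G x * degA G y ≤ 8 * lightPaths y x
  edge-on-many-light-paths 1≤p {y} {x} yx 16p≤dB 16p≤dA =
    light-paths-dominate 1≤p 16p≤dB 16p≤dA (≤-trans (paths-lower yx) (paths-upper y x))

-- Deleting vertices of low degree

module Cleaning {m n : ℕ} (M N E : ℕ) where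

  charge : BipGraph m n → ℕ
  charge H = N * E * activeA H + M * E * activeB H

  infix 4 _⇝_

  -- M·N·(edges lost) is paid for by the drop in charge: deleting a vertex of A of degree d
  -- with M·d < E lowers the charge by N·E > M·N·d, and symmetrically for B.

  _⇝_ : BipGraph m n → BipGraph m n → Set
  H ⇝ H′ = H′ ⊆ H × M * N * edgeCount H + charge H′ ≤ M * N * edgeCount H′ + charge H

  HeavyEnds : BipGraph m n → Set
  HeavyEnds H = ∀ i j → T (H i j) → E ≤ M * degA H i × E ≤ N * degB H j

  ⇝-refl : ∀ {H} → H ⇝ H
  ⇝-refl = (λ _ _ → id) , ≤-refl

  ⇝-trans : ∀ {H H′ H″} → H ⇝ H′ → H′ ⇝ H″ → H ⇝ H″
  ⇝-trans {H} {H′} {H″} (H′⊆H , cheap) (H″⊆H′ , cheap′) =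
    (λ i j → H′⊆H i j ∘ H″⊆H′ i j) ,
    cross-≤-trans {M * N * edgeCount H} {M * N * edgeCount H′} {M * N * edgeCount H″}
                  {charge H} {charge H′} {charge H″} cheap cheap′

  ⇝-by-deletion : ∀ {H H′ d} → H′ ⊆ H → edgeCount H ≡ d + edgeCount H′ →
                  M * N * d + charge H′ ≤ charge H → H ⇝ H′
  ⇝-by-deletion {H} {H′} {d} H′⊆H split paid = H′⊆H , (begin
    M * N * edgeCount H + charge H′                   ≡⟨ cong (λ e → M * N * e + charge H′) split ⟩
    M * N * (d + edgeCount H′) + charge H′            ≡⟨ regroup (M * N) d (edgeCount H′) (charge H′) ⟩
    M * N * edgeCount H′ + (M * N * d + charge H′)    ≤⟨ +-monoʳ-≤ (M * N * edgeCount H′) paid ⟩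
    M * N * edgeCount H′ + charge H                   ∎)
    where
    open ≤-Reasoning
    regroup : ∀ k d e c → k * (d + e) + c ≡ k * e + (k * d + c)
    regroup = solve-∀

  ⇝-deleteRow : ∀ {H i} → 1 ≤ degA H i → M * degA H i < E → H ⇝ deleteRow H i
  ⇝-deleteRow {H} {i} active small = ⇝-by-deletion (deleteRow-⊆ H i) (edgeCount-deleteRow H i) (begin
    M * N * d + (N * E * a′ + M * E * b′)
      ≤⟨ +-monoˡ-≤ _ (≤-trans (≤-reflexive (reorder M N d)) (*-monoʳ-≤ N (<⇒≤ small))) ⟩
    N * E + (N * E * a′ + M * E * b′)         ≡⟨ absorb (N * E) a′ (M * E * b′) ⟩
    N * E * suc a′ + M * E * b′               ≤⟨ +-mono-≤ (*-monoʳ-≤ (N * E) (activeA-deleteRow H i active))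
                                                          (*-monoʳ-≤ (M * E) (activeB-deleteRow H i)) ⟩
    charge H                                  ∎)
    where
    open ≤-Reasoning
    d  = degA H i
    a′ = activeA (deleteRow H i)
    b′ = activeB (deleteRow H i)
    reorder : ∀ M N d → M * N * d ≡ N * (M * d)
    reorder = solve-∀
    absorb : ∀ k a c → k + (k * a + c) ≡ k * suc a + c
    absorb = solve-∀

  ⇝-deleteCol : ∀ {H j} → 1 ≤ degB H j → N * degB H j < E → H ⇝ deleteCol H j
  ⇝-deleteCol {H} {j} active small = ⇝-by-deletion (deleteCol-⊆ H j) (edgeCount-deleteCol H j) (begin
    M * N * d + (N * E * a′ + M * E * b′)
      ≤⟨ +-monoˡ-≤ _ (≤-trans (≤-reflexive (*-assoc M N d)) (*-monoʳ-≤ M (<⇒≤ small))) ⟩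
    M * E + (N * E * a′ + M * E * b′)         ≡⟨ absorb (M * E) (N * E * a′) b′ ⟩
    N * E * a′ + M * E * suc b′               ≤⟨ +-mono-≤ (*-monoʳ-≤ (N * E) (activeA-deleteCol H j))
                                                          (*-monoʳ-≤ (M * E) (activeB-deleteCol H j active)) ⟩
    charge H                                  ∎)
    where
    open ≤-Reasoning
    d  = degB H j
    a′ = activeA (deleteCol H j)
    b′ = activeB (deleteCol H j)
    absorb : ∀ k c b → k + (c + k * b) ≡ c + k * suc b
    absorb = solve-∀

  clean : ∀ k H → activeA H + activeB H < k → ∃ λ H′ → H ⇝ H′ × HeavyEnds H′
  clean (suc k) H (s≤s size≤k) =
    step (any? (λ i → (1 ≤? degA H i) ×-dec (M * degA H i <? E)))
         (any? (λ j → (1 ≤? degB H j) ×-dec (N * degB H j <? E)))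
    where
    continue : ∀ {H′} → H ⇝ H′ → activeA H′ + activeB H′ < activeA H + activeB H →
               ∃ λ H″ → H ⇝ H″ × HeavyEnds H″
    continue H⇝H′ smaller with clean k _ (≤-trans smaller size≤k)
    ... | H″ , H′⇝H″ , heavy = H″ , ⇝-trans H⇝H′ H′⇝H″ , heavy

    step : Dec (∃ λ i → 1 ≤ degA H i × M * degA H i < E) → Dec (∃ λ j → 1 ≤ degB H j × N * degB H j < E) →
           ∃ λ H′ → H ⇝ H′ × HeavyEnds H′
    step (yes (i , active , small)) _ =
      continue (⇝-deleteRow active small)
               (+-mono-≤ (activeA-deleteRow H i active) (activeB-deleteRow H i))
    step (no _) (yes (j , active , small)) =
      continue (⇝-deleteCol active small)
               (≤-trans (≤-reflexive (sym (+-suc _ _))) (+-mono-≤ (activeA-deleteCol H j) (activeB-deleteCol H j active)))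
    step (no noSmallRow) (no noSmallCol) = H , ⇝-refl , λ i j ij →
      ≮⇒≥ (λ small → noSmallRow (i , edge⇒degA-positive H ij , small)) ,
      ≮⇒≥ (λ small → noSmallCol (j , edge⇒degA-positive (transpose H) ij , small))

  cleaned : ∀ H → ∃ λ H′ → H ⇝ H′ × HeavyEnds H′
  cleaned H = clean (suc (activeA H + activeB H)) H ≤-refl

cleaning-keeps-half : ∀ {m n} .{{_ : NonZero m}} .{{_ : NonZero n}} (G H : BipGraph m n) →
                      Cleaning._⇝_ (4 * m) (4 * n) (edgeCount G) G H → edgeCount G ≤ 2 * edgeCount H
cleaning-keeps-half {m} {n} G H (_ , cheap) =
  *-cancelˡ-≤ 8 (+-cancelʳ-≤ (8 * E) _ _ (≤-trans (≤-reflexive (double E))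
    (*-cancelˡ-≤ (m * n) {{m*n≢0 m n}} (begin
      m * n * (16 * E)                                                  ≡⟨ regroup₁ m n E ⟩
      4 * m * (4 * n) * E                                               ≤⟨ m≤m+n _ _ ⟩
      4 * m * (4 * n) * E + charge H                                    ≤⟨ cheap ⟩
      4 * m * (4 * n) * E′ + (4 * n * E * activeA G + 4 * m * E * activeB G)
        ≤⟨ +-monoʳ-≤ (4 * m * (4 * n) * E′) (+-mono-≤ (*-monoʳ-≤ (4 * n * E) (activeA-≤ G))
                                                      (*-monoʳ-≤ (4 * m * E) (activeB-≤ G))) ⟩
      4 * m * (4 * n) * E′ + (4 * n * E * m + 4 * m * E * n)            ≡⟨ regroup₂ m n E E′ ⟩
      m * n * (8 * (2 * E′) + 8 * E)                                    ∎))))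
  where
  open ≤-Reasoning
  open Cleaning (4 * m) (4 * n) (edgeCount G) using (charge)
  E  = edgeCount G
  E′ = edgeCount H
  double : ∀ E → 8 * E + 8 * E ≡ 16 * E
  double = solve-∀
  regroup₁ : ∀ m n E → m * n * (16 * E) ≡ 4 * m * (4 * n) * E
  regroup₁ = solve-∀
  regroup₂ : ∀ m n E E′ → 4 * m * (4 * n) * E′ + (4 * n * E * m + 4 * m * E * n) ≡ m * n * (8 * (2 * E′) + 8 * E)
  regroup₂ = solve-∀

dense-θ-free-bound : ∀ {m n} .{{_ : NonZero m}} .{{_ : NonZero n}} p (G : BipGraph m n) →
                     ¬ ContainsTheta p G → 1 ≤ p → 64 * p * (m + n) ≤ edgeCount G →
                     edgeCount G ^ 3 ≤ 512 * (p * p) * (m * n) ^ 2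
dense-θ-free-bound {m} {n} p G free 1≤p dense with Cleaning.cleaned (4 * m) (4 * n) (edgeCount G) G
... | H , G⇝H@(H⊆G , _) , heavy = begin
  E ^ 3                                                ≡⟨ cube E ⟩
  E * (E * E)                                          ≤⟨ *-monoˡ-≤ (E * E) (cleaning-keeps-half G H G⇝H) ⟩
  2 * edgeCount H * (E * E)                            ≡⟨ *-assoc 2 (edgeCount H) (E * E) ⟩
  2 * (edgeCount H * (E * E))
    ≤⟨ *-monoʳ-≤ 2 (count₂-weighted (λ y x → T? (H y x)) (λ y x → K * lightPaths y x) per-edge) ⟩
  2 * (∑[ y < m ] ∑[ x < n ] (K * lightPaths y x))     ≡⟨ cong (2 *_) (∑∑-*ˡ K lightPaths) ⟩
  2 * (K * (∑[ y < m ] ∑[ x < n ] lightPaths y x))     ≤⟨ *-monoʳ-≤ 2 (*-monoʳ-≤ K lightPaths-total) ⟩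
  2 * (K * (m * n * (p * (p + p))))                    ≡⟨ regroup (m * n) p ⟩
  512 * (p * p) * (m * n) ^ 2                          ∎
  where
  open ≤-Reasoning
  open ThetaFree p H (free ∘ ContainsTheta-mono p H⊆G)
  E = edgeCount G
  K = 128 * (m * n)

  cube : ∀ e → e ^ 3 ≡ e * (e * e)
  cube e = cong (λ x → e * (e * x)) (*-identityʳ e)
  regroup : ∀ k p → 2 * (128 * k * (k * (p * (p + p)))) ≡ 512 * (p * p) * (k * (k * 1))
  regroup = solve-∀

  per-edge : ∀ y x → T (H y x) → E * E ≤ K * lightPaths y x
  per-edge y x yx = begin
    E * E                                       ≤⟨ *-mono-≤ heavyA heavyB ⟩
    4 * m * degA H y * (4 * n * degB H x)       ≡⟨ reorder m n (degA H y) (degB H x) ⟩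
    16 * (m * n) * (degB H x * degA H y)        ≤⟨ *-monoʳ-≤ (16 * (m * n)) (edge-on-many-light-paths 1≤p yx
                                                      16p≤degB 16p≤degA) ⟩
    16 * (m * n) * (8 * lightPaths y x)         ≡⟨ *-assoc 16 (m * n) _ ⟩
    16 * (m * n * (8 * lightPaths y x))         ≡⟨ sym (reassoc (m * n) (lightPaths y x)) ⟩
    K * lightPaths y x                          ∎
    where
    heavyA = proj₁ (heavy y x yx)
    heavyB = proj₂ (heavy y x yx)
    16p≤degA : 16 * p ≤ degA H y
    16p≤degA = degree-above-threshold m p (≤-trans (*-monoʳ-≤ (64 * p) (m≤m+n m n)) dense) heavyA
    16p≤degB : 16 * p ≤ degB H x
    16p≤degB = degree-above-threshold n p (≤-trans (*-monoʳ-≤ (64 * p) (m≤n+m n m)) dense) heavyB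
    reorder : ∀ m n a b → 4 * m * a * (4 * n * b) ≡ 16 * (m * n) * (b * a)
    reorder = solve-∀
    reassoc : ∀ k l → 128 * k * l ≡ 16 * (k * (8 * l))
    reassoc = solve-∀

corollary4p2 : (m n p : ℕ) → 2 ≤ m → 2 ≤ n → 2 ≤ p →
    (G : BipGraph m n) → ¬ ContainsTheta p G →
    (edges G ∸ (144 * p ^ 3) * (m + n)) ^ 3 ≤ (144 * p ^ 3) ^ 3 * (m * n) ^ 2
corollary4p2 m n p 2≤m 2≤n 2≤p G free rewrite edges≡edgeCount G with edgeCount G ≤? 144 * p ^ 3 * (m + n)
... | yes sparse = ≤-trans (≤-reflexive (cong (_^ 3) (m≤n⇒m∸n≡0 sparse))) z≤n
... | no dense = begin
  (edgeCount G ∸ 144 * p ^ 3 * (m + n)) ^ 3   ≤⟨ ^-monoˡ-≤ 3 (m∸n≤m (edgeCount G) (144 * p ^ 3 * (m + n))) ⟩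
  edgeCount G ^ 3                              ≤⟨ dense-θ-free-bound p G free 1≤p many-edges ⟩
  512 * (p * p) * (m * n) ^ 2                  ≤⟨ *-monoˡ-≤ ((m * n) ^ 2) (512p²≤[144p³]³ p) ⟩
  (144 * p ^ 3) ^ 3 * (m * n) ^ 2              ∎
  where
  open ≤-Reasoning
  1≤p = ≤-trans (s≤s z≤n) 2≤p
  instance
    _ = >-nonZero (≤-trans (s≤s z≤n) 2≤m)
    _ = >-nonZero (≤-trans (s≤s z≤n) 2≤n)
    _ = >-nonZero 1≤p
  many-edges : 64 * p * (m + n) ≤ edgeCount G
  many-edges = ≤-trans (*-monoˡ-≤ (m + n) (64p≤144p³ p)) (<⇒≤ (≰⇒> dense))
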